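{- For a visibility graph $G$, the following are equivalent: (1) the vertices of $G$ are not all collinear; (2) $\kappa(G)\ge 2$; (3) $\lambda(G)\ge 2$; (4) $\delta(G)\ge 2$.
   Context: For a finite set $P$ of points in the plane, two distinct points $v,w$ are visible with respect to $P$ if no point of $P$ lies in the open line segment $vw$. The visibility graph of $P$ has vertex set $P$, with $v,w$ adjacent iff they are visible with respect to $P$. $\kappa$, $\lambda$, $\delta$ denote vertex-connectivity, edge-connectivity and minimum degree. -}

module Defs where

open import Level using (0ℓ)
open import Data.Nat using (ℕ) renaming (_<_ to _<ℕ_)
open import Data.Fin using (Fin)
open import Data.Fin.Subset using (Subset; _∉_; ∣_∣)
open import Data.Product using (Σ; ∃; _×_; _,_)
open import Data.Sum using (_⊎_)
open import Data.List using (List; length)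
open import Data.List.Membership.Propositional using (_∈_)
open import Relation.Nullary using (¬_)
open import Relation.Binary.PropositionalEquality using (_≡_; _≢_)
open import Relation.Binary.Structures using (IsStrictTotalOrder)
open import Relation.Binary.Construct.Closure.ReflexiveTransitive using (Star)
open import Algebra.Structures using (IsCommutativeRing)
open import Function.Definitions using (Injective)

-- Ordered fields (the real plane ℝ² is the intended instance; stdlib has
-- no reals, so we work over an arbitrary (discrete) ordered field).

record OrderedField : Set₁ where
  infixl 6 _+_
  infixl 7 _*_
  infix  4 _<_
  field
    Carrier : Set
    _+_ _*_ : Carrier → Carrier → Carrier
    -_      : Carrier → Carrier
    0# 1#   : Carrier
    _<_     : Carrier → Carrier → Set
    isCommutativeRing : IsCommutativeRing _≡_ _+_ _*_ -_ 0# 1#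
    isStrictTotalOrder : IsStrictTotalOrder _≡_ _<_
    0<1     : 0# < 1#
    +-mono-< : ∀ {a b} c → a < b → a + c < b + c
    *-pos    : ∀ {a b} → 0# < a → 0# < b → 0# < a * b
    inverse  : ∀ a → a ≢ 0# → Σ Carrier (λ b → a * b ≡ 1#)

module Geometry (F : OrderedField) where
  open OrderedField F

  _-_ : Carrier → Carrier → Carrier
  a - b = a + (- b)

  Point : Set
  Point = Carrier × Carrier

  InOpenSegment : Point → Point → Point → Set
  InOpenSegment (ux , uy) (vx , vy) (wx , wy) =
    Σ Carrier λ t → (0# < t) × (t < 1#) ×
      (ux ≡ (1# - t) * vx + t * wx) × (uy ≡ (1# - t) * vy + t * wy)

  AllCollinear : ∀ {n} → (Fin n → Point) → Set
  AllCollinear {n} p = Σ Carrier λ a → Σ Carrier λ b → Σ Carrier λ c →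
    ¬ (a ≡ 0# × b ≡ 0#) ×
    (∀ i → let (x , y) = p i in a * x + b * y + c ≡ 0#)

  Visible : ∀ {n} → (Fin n → Point) → Fin n → Fin n → Set
  Visible {n} p i j = i ≢ j × ¬ (∃ λ (k : Fin n) → InOpenSegment (p k) (p i) (p j))

Graph : ℕ → Set₁
Graph n = Fin n → Fin n → Set

ConnectedAvoiding : ∀ {n} → Graph n → Subset n → Set
ConnectedAvoiding {n} G X = ∀ u v → u ∉ X → v ∉ X →
  Star (λ a b → a ∉ X × b ∉ X × G a b) u v

KConnected : ∀ {n} → ℕ → Graph n → Set
KConnected {n} k G = (k <ℕ n) × (∀ (X : Subset n) → ∣ X ∣ <ℕ k → ConnectedAvoiding G X)

RemoveEdges : ∀ {n} → Graph n → List (Fin n × Fin n) → Graph n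
RemoveEdges G F a b = G a b × ¬ ((a , b) ∈ F ⊎ (b , a) ∈ F)

Connected : ∀ {n} → Graph n → Set
Connected {n} G = ∀ (u v : Fin n) → Star G u v

KEdgeConnected : ∀ {n} → ℕ → Graph n → Set
KEdgeConnected {n} k G = (1 <ℕ n) ×
  (∀ (F : List (Fin n × Fin n)) → length F <ℕ k → Connected (RemoveEdges G F))

MinDegreeAtLeast : ∀ {n} → ℕ → Graph n → Set
MinDegreeAtLeast {n} k G = ∀ (v : Fin n) →
  Σ (Fin k → Fin n) λ f → Injective _≡_ _≡_ f × (∀ j → G v (f j))

-- If the points are not all collinear, deleting any vertex v leaves the visibility graph
-- connected: consecutive points on the line uw see each other, so they form a walk from u
-- to w, and when v is on that line one goes round it through a point z off the line, since
-- the lines uz and zw meet uw only at u and w. Vertex 2-connectivity gives edge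
-- 2-connectivity, which gives minimum degree 2. If the points are collinear, an extreme
-- point sees only its nearest neighbour, so the minimum degree is at most 1.
module Submission where

open import Defs
open import Level using (0ℓ)
open import Data.Nat as ℕ using (ℕ; zero; suc; z≤n; s≤s; _≥_)
import Data.Nat.Properties as ℕ
open import Data.Fin using (Fin; zero; suc; punchIn; fromℕ<)
open import Data.Fin.Properties using (punchInᵢ≢i; punchIn-injective; 0≢1+n; ¬∀⟶∃¬)
  renaming (_≟_ to _≟ᶠ_)
open import Data.Fin.Subset using (Subset; _∈_; _∉_; _⊆_; _⊂_; ⊥; ⁅_⁆; ∣_∣)
open import Data.Fin.Subset.Properties
  using (nonempty?; p⊂q⇒∣p∣<∣q∣; ∉⊥; ∣⊥∣≡0; ∣⁅x⁆∣≡1; x∈⁅x⁆; x∈⁅y⁆⇒x≡y; x≢y⇒x∉⁅y⁆; x∉⁅y⁆⇒x≢y)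
open import Data.Fin.Subset.Induction using (⊂-wellFounded; Acc; acc)
open import Data.Vec using (tabulate)
open import Data.Vec.Properties using (lookup∘tabulate; lookup⇒[]=; []=⇒lookup)
open import Data.List using ([]; _∷_; allFin)
open import Data.List.Relation.Unary.All using (lookup)
open import Data.List.Relation.Unary.Any using (here)
open import Data.List.Membership.Propositional using () renaming (_∈_ to _∈ˡ_)
open import Data.List.Membership.Propositional.Properties using (∈-allFin)
import Data.List.Membership.DecPropositional as DecMembership
import Data.List.Extrema as Extrema
open import Data.Product using (Σ; ∃; ∃₂; _×_; _,_; proj₁; proj₂)
open import Data.Product.Properties using (≡-dec)
open import Data.Sum using (_⊎_; inj₁; inj₂)
open import Data.Empty using (⊥-elim)
open import Data.Maybe using (Maybe; nothing; map)
open import Function using (_∘_; id; _⇔_; mk⇔; Equivalence)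
open import Function.Definitions using (Injective)
open import Relation.Nullary using (¬_; yes; no; does; contradiction)
open import Relation.Nullary.Decidable using (dec⇒maybe; dec-true; _×-dec_; _⊎-dec_)
open import Relation.Unary using (Pred; Decidable)
open import Relation.Binary.PropositionalEquality
open import Relation.Binary.Definitions using (tri<; tri≈; tri>)
open import Relation.Binary.Structures using (IsStrictTotalOrder)
open import Relation.Binary.Bundles using (TotalOrder)
import Relation.Binary.Construct.StrictToNonStrict as StrictToNonStrict
open import Relation.Binary.Construct.Closure.ReflexiveTransitive using (Star; ε; _◅_; _◅◅_; gmap; _⋆)
open import Algebra.Bundles using (CommutativeRing; RawRing)
open import Algebra.Solver.Ring.AlmostCommutativeRing
  using (AlmostCommutativeRing; fromCommutativeRing; _-Raw-AlmostCommutative⟶_; -raw-almostCommutative⟶)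
import Algebra.Solver.Ring as RingSolver

module OrderedFieldProperties (F : OrderedField) where

  open OrderedField F public
    using (_<_; 0<1; +-mono-<; *-pos; inverse; isStrictTotalOrder)
  open IsStrictTotalOrder isStrictTotalOrder public
    using (compare; _≟_; _<?_) renaming (trans to <-trans; irrefl to <-irrefl)

  commutativeRing : CommutativeRing 0ℓ 0ℓ
  commutativeRing = record { isCommutativeRing = OrderedField.isCommutativeRing F }

  open CommutativeRing commutativeRing public
    using (Carrier; _+_; _*_; -_; _-_; 0#; 1#)
  open CommutativeRing commutativeRing
    using (+-identityʳ; -‿inverseʳ; semiring; ring; +-abelianGroup)
  open import Algebra.Properties.Ring ring using (-‿involutive; x[y-z]≈xy-xz; [y-z]x≈yx-zx)
  open import Algebra.Properties.AbelianGroup +-abelianGroup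
    using (⁻¹-anti-homo‿-; x∙y⁻¹≈ε⇒x≈y; x≈y⇒x∙y⁻¹≈ε; ε⁻¹≈ε)
  open import Algebra.Properties.Semiring.Mult.TCOptimised semiring
    using (×-homo-+; ×1-homo-*; 1+×) renaming (_×_ to _×ᵤ_)

  almostCommutativeRing : AlmostCommutativeRing 0ℓ 0ℓ
  almostCommutativeRing = fromCommutativeRing commutativeRing

  -- The ring solver needs coefficients with decidable equality and unique representatives;
  -- the field's own elements do not qualify, so integers are used, the pair (m , n)
  -- standing for m - n and kept normalised (one of m, n is zero).
  module IntegerCoefficients where

    -- This solver works with the field's own elements as coefficients, so it cannot
    -- cancel x - x; such steps are taken by hand.
    private
      module Bootstrap = RingSolver (AlmostCommutativeRing.rawRing almostCommutativeRing)
        almostCommutativeRing (-raw-almostCommutative⟶ almostCommutativeRing) (λ _ _ → nothing)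
      open Bootstrap using (solve; _:=_; _:+_; _:-_; :-_)
      open ≡-Reasoning

      ι : ℕ → Carrier
      ι n = n ×ᵤ 1#

      [z+x]-[z+y]≡x-y : ∀ x y z → (z + x) - (z + y) ≡ x - y
      [z+x]-[z+y]≡x-y x y z = begin
        (z + x) - (z + y)   ≡⟨ solve 3 (λ x y z → (z :+ x) :- (z :+ y) := (x :- y) :+ (z :- z)) refl x y z ⟩
        (x - y) + (z - z)   ≡⟨ cong ((x - y) +_) (-‿inverseʳ z) ⟩
        (x - y) + 0#        ≡⟨ +-identityʳ (x - y) ⟩
        x - y               ∎

      [p-q]-[r-s]≡[p+s]-[q+r] : ∀ p q r s → (p - q) - (r - s) ≡ (p + s) - (q + r)
      [p-q]-[r-s]≡[p+s]-[q+r] p q r s = begin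
        (p - q) - (r - s)      ≡⟨ solve 4 (λ p q r s → (p :- q) :- (r :- s) := p :- q :- r :+ :- (:- s)) refl p q r s ⟩
        p - q - r + - (- s)    ≡⟨ cong (p - q - r +_) (-‿involutive s) ⟩
        p - q - r + s          ≡⟨ solve 4 (λ p q r s → p :- q :- r :+ s := (p :+ s) :- (q :+ r)) refl p q r s ⟩
        (p + s) - (q + r)      ∎

      ι-+-* : ∀ a b c d → ι (a ℕ.* b ℕ.+ c ℕ.* d) ≡ ι a * ι b + ι c * ι d
      ι-+-* a b c d = trans (×-homo-+ 1# (a ℕ.* b) (c ℕ.* d)) (cong₂ _+_ (×1-homo-* a b) (×1-homo-* c d))

    normalise : ℕ × ℕ → ℕ × ℕ
    normalise (m , n) = (m ℕ.∸ n , n ℕ.∸ m)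

    _⊕_ _⊛_ : ℕ × ℕ → ℕ × ℕ → ℕ × ℕ
    (a , b) ⊕ (c , d) = (a ℕ.+ c , b ℕ.+ d)
    (a , b) ⊛ (c , d) = (a ℕ.* c ℕ.+ b ℕ.* d , a ℕ.* d ℕ.+ b ℕ.* c)

    ℤ-coefficients : RawRing 0ℓ 0ℓ
    ℤ-coefficients = record
      { Carrier = ℕ × ℕ
      ; _≈_     = _≡_
      ; _+_     = λ x y → normalise (x ⊕ y)
      ; _*_     = λ x y → normalise (x ⊛ y)
      ; -_      = λ (a , b) → (b , a)
      ; 0#      = (0 , 0)
      ; 1#      = (1 , 0)
      }

    difference : ℕ × ℕ → Carrier
    difference (m , n) = ι m - ι n

    -- Agrees with difference, but sends 0 and 1 to 0# and 1# on the nose, as the solver's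
    -- constants must denote them.
    ⟦_⟧ : ℕ × ℕ → Carrier
    ⟦ m , zero ⟧ = ι m
    ⟦ m , suc n ⟧ = difference (m , suc n)

    ⟦⟧≡difference : ∀ x → ⟦ x ⟧ ≡ difference x
    ⟦⟧≡difference (m , zero) = begin
      ι m           ≡⟨ +-identityʳ (ι m) ⟨
      ι m + 0#      ≡⟨ cong (ι m +_) ε⁻¹≈ε ⟨
      ι m - 0#      ∎
    ⟦⟧≡difference (m , suc n) = refl

    difference-normalise : ∀ m n → difference (normalise (m , n)) ≡ difference (m , n)
    difference-normalise zero    zero    = refl
    difference-normalise zero    (suc n) = refl
    difference-normalise (suc m) zero    = refl
    difference-normalise (suc m) (suc n) = begin
      difference (normalise (m , n))   ≡⟨ difference-normalise m n ⟩
      ι m - ι n                        ≡⟨ [z+x]-[z+y]≡x-y (ι m) (ι n) 1# ⟨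
      (1# + ι m) - (1# + ι n)          ≡⟨ cong₂ _-_ (1+× m 1#) (1+× n 1#) ⟨
      ι (suc m) - ι (suc n)            ∎

    normalise-homo : ∀ {f : ℕ × ℕ → ℕ × ℕ → ℕ × ℕ} {_∙_ : Carrier → Carrier → Carrier} →
      (∀ x y → difference (f x y) ≡ difference x ∙ difference y) →
      ∀ x y → ⟦ normalise (f x y) ⟧ ≡ ⟦ x ⟧ ∙ ⟦ y ⟧
    normalise-homo {f} {_∙_} homo x y = begin
      ⟦ normalise (f x y) ⟧           ≡⟨ ⟦⟧≡difference (normalise (f x y)) ⟩
      difference (normalise (f x y))  ≡⟨ difference-normalise (proj₁ (f x y)) (proj₂ (f x y)) ⟩
      difference (f x y)              ≡⟨ homo x y ⟩
      difference x ∙ difference y     ≡⟨ cong₂ _∙_ (⟦⟧≡difference x) (⟦⟧≡difference y) ⟨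
      ⟦ x ⟧ ∙ ⟦ y ⟧                   ∎

    ℤ-morphism : ℤ-coefficients -Raw-AlmostCommutative⟶ almostCommutativeRing
    ℤ-morphism = record
      { ⟦_⟧    = ⟦_⟧
      ; +-homo = normalise-homo {_⊕_} {_+_} λ (a , b) (c , d) → begin
          ι (a ℕ.+ c) - ι (b ℕ.+ d)    ≡⟨ cong₂ _-_ (×-homo-+ 1# a c) (×-homo-+ 1# b d) ⟩
          (ι a + ι c) - (ι b + ι d)
            ≡⟨ solve 4 (λ a b c d → (a :+ c) :- (b :+ d) := (a :- b) :+ (c :- d)) refl (ι a) (ι b) (ι c) (ι d) ⟩
          (ι a - ι b) + (ι c - ι d)    ∎
      ; *-homo = normalise-homo {_⊛_} {_*_} λ (a , b) (c , d) → begin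
          ι (a ℕ.* c ℕ.+ b ℕ.* d) - ι (a ℕ.* d ℕ.+ b ℕ.* c)
            ≡⟨ cong₂ _-_ (ι-+-* a c b d) (ι-+-* a d b c) ⟩
          (ι a * ι c + ι b * ι d) - (ι a * ι d + ι b * ι c)
            ≡⟨ [p-q]-[r-s]≡[p+s]-[q+r] (ι a * ι c) (ι a * ι d) (ι b * ι c) (ι b * ι d) ⟨
          (ι a * ι c - ι a * ι d) - (ι b * ι c - ι b * ι d)
            ≡⟨ cong₂ _-_ (x[y-z]≈xy-xz (ι a) (ι c) (ι d)) (x[y-z]≈xy-xz (ι b) (ι c) (ι d)) ⟨
          ι a * (ι c - ι d) - ι b * (ι c - ι d)
            ≡⟨ [y-z]x≈yx-zx (ι c - ι d) (ι a) (ι b) ⟨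
          (ι a - ι b) * (ι c - ι d)   ∎
      ; -‿homo = λ (a , b) → begin
          ⟦ b , a ⟧        ≡⟨ ⟦⟧≡difference (b , a) ⟩
          ι b - ι a        ≡⟨ ⁻¹-anti-homo‿- (ι a) (ι b) ⟨
          - (ι a - ι b)    ≡⟨ cong -_ (⟦⟧≡difference (a , b)) ⟨
          - ⟦ a , b ⟧      ∎
      ; 0-homo = refl
      ; 1-homo = refl
      }

    ⟦⟧-equal? : ∀ x y → Maybe (⟦ x ⟧ ≡ ⟦ y ⟧)
    ⟦⟧-equal? x y = map (cong ⟦_⟧) (dec⇒maybe (≡-dec ℕ._≟_ ℕ._≟_ x y))

  open IntegerCoefficients using (ℤ-coefficients; ℤ-morphism; ⟦⟧-equal?)
  open RingSolver ℤ-coefficients almostCommutativeRing ℤ-morphism ⟦⟧-equal? public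
    using (Polynomial; solve; _:=_; _:+_; _:*_; _:-_; :-_; con)

  :0 :1 : ∀ {m} → Polynomial m
  :0 = con (0 , 0)
  :1 = con (1 , 0)

  ≤-totalOrder : TotalOrder 0ℓ 0ℓ 0ℓ
  ≤-totalOrder = record { isTotalOrder = StrictToNonStrict.isTotalOrder _≡_ _<_ isStrictTotalOrder }

  <⇒≢ : ∀ {x y} → x < y → x ≢ y
  <⇒≢ x<y refl = <-irrefl refl x<y

  x<y⇒0<y-x : ∀ {x y} → x < y → 0# < y - x
  x<y⇒0<y-x {x} {y} x<y = subst (_< y - x) (solve 1 (λ x → x :- x := :0) refl x) (+-mono-< (- x) x<y)

  0<y-x⇒x<y : ∀ {x y} → 0# < y - x → x < y
  0<y-x⇒x<y {x} {y} 0<y-x =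
    subst₂ _<_ (solve 1 (λ x → :0 :+ x := x) refl x) (solve 2 (λ x y → y :- x :+ x := y) refl x y)
      (+-mono-< x 0<y-x)

  x<0⇒0<-x : ∀ {x} → x < 0# → 0# < - x
  x<0⇒0<-x {x} x<0 = subst (0# <_) (solve 1 (λ x → :0 :- x := :- x) refl x) (x<y⇒0<y-x x<0)

  0<x⇒0<y⇒0<x+y : ∀ {x y} → 0# < x → 0# < y → 0# < x + y
  0<x⇒0<y⇒0<x+y {x} {y} 0<x 0<y =
    <-trans 0<y (subst₂ _<_ (solve 1 (λ y → :0 :+ y := y) refl y) refl (+-mono-< y 0<x))

  x≢0⇒0<x*x : ∀ {x} → x ≢ 0# → 0# < x * x
  x≢0⇒0<x*x {x} x≢0 with compare x 0#
  ... | tri< x<0 _ _ = subst (0# <_) (solve 1 (λ x → :- x :* :- x := x :* x) refl x)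
                         (*-pos (x<0⇒0<-x x<0) (x<0⇒0<-x x<0))
  ... | tri≈ _ x≡0 _ = contradiction x≡0 x≢0
  ... | tri> _ _ 0<x = *-pos 0<x 0<x

  0<sum-of-squares : ∀ {x y} → ¬ (x ≡ 0# × y ≡ 0#) → 0# < x * x + y * y
  0<sum-of-squares {x} {y} nonzero with x ≟ 0# | y ≟ 0#
  ... | yes refl | yes refl = contradiction (refl , refl) nonzero
  ... | yes refl | no y≢0 = subst (0# <_) (solve 1 (λ y → y :* y := :0 :* :0 :+ y :* y) refl y) (x≢0⇒0<x*x y≢0)
  ... | no x≢0 | yes refl = subst (0# <_) (solve 1 (λ x → x :* x := x :* x :+ :0 :* :0) refl x) (x≢0⇒0<x*x x≢0)
  ... | no x≢0 | no y≢0 = 0<x⇒0<y⇒0<x+y (x≢0⇒0<x*x x≢0) (x≢0⇒0<x*x y≢0)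

  x≢0⇒x*y≡0⇒y≡0 : ∀ {x y} → x ≢ 0# → x * y ≡ 0# → y ≡ 0#
  x≢0⇒x*y≡0⇒y≡0 {x} {y} x≢0 x*y≡0 with inverse x x≢0
  ... | x⁻¹ , x*x⁻¹≡1 = begin
    y               ≡⟨ solve 1 (λ y → y := :1 :* y) refl y ⟩
    1# * y          ≡⟨ cong (_* y) x*x⁻¹≡1 ⟨
    x * x⁻¹ * y     ≡⟨ solve 3 (λ x x⁻¹ y → x :* x⁻¹ :* y := x⁻¹ :* (x :* y)) refl x x⁻¹ y ⟩
    x⁻¹ * (x * y)   ≡⟨ cong (x⁻¹ *_) x*y≡0 ⟩
    x⁻¹ * 0#        ≡⟨ solve 1 (λ x⁻¹ → x⁻¹ :* :0 := :0) refl x⁻¹ ⟩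
    0#              ∎
    where open ≡-Reasoning

  x-y≡0⇒x≡y : ∀ {x y} → x - y ≡ 0# → x ≡ y
  x-y≡0⇒x≡y = x∙y⁻¹≈ε⇒x≈y _ _

  x≡y⇒x-y≡0 : ∀ {x y} → x ≡ y → x - y ≡ 0#
  x≡y⇒x-y≡0 = x≈y⇒x∙y⁻¹≈ε

  x≢0⇒x*[y-z]≡0⇒y≡z : ∀ {x y z} → x ≢ 0# → x * (y - z) ≡ 0# → y ≡ z
  x≢0⇒x*[y-z]≡0⇒y≡z x≢0 = x-y≡0⇒x≡y ∘ x≢0⇒x*y≡0⇒y≡0 x≢0

  s*0+t*0≡0 : ∀ s t {x y} → x ≡ 0# → y ≡ 0# → s * x + t * y ≡ 0#
  s*0+t*0≡0 s t refl refl = solve 2 (λ s t → s :* :0 :+ t :* :0 := :0) refl s t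

  x≡0⇒-x≡0 : ∀ {x} → x ≡ 0# → - x ≡ 0#
  x≡0⇒-x≡0 refl = ε⁻¹≈ε

  0<x⇒x*y≡1⇒0<y : ∀ {x y} → 0# < x → x * y ≡ 1# → 0# < y
  0<x⇒x*y≡1⇒0<y {x} {y} 0<x x*y≡1 with compare y 0#
  ... | tri> _ _ 0<y = 0<y
  ... | tri≈ _ refl _ = contradiction (trans (solve 1 (λ x → :0 := x :* :0) refl x) x*y≡1) (<⇒≢ 0<1)
  ... | tri< y<0 _ _ = ⊥-elim (<-irrefl refl (<-trans 0<1 1<0))
    where
    0<-1 : 0# < - 1#
    0<-1 = subst (λ z → 0# < - z) x*y≡1
             (subst (0# <_) (solve 2 (λ x y → x :* :- y := :- (x :* y)) refl x y) (*-pos 0<x (x<0⇒0<-x y<0)))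
    1<0 : 1# < 0#
    1<0 = 0<y-x⇒x<y (subst (0# <_) (solve 0 (:- :1 := :0 :- :1) refl) 0<-1)

  convex-combination-between : ∀ {x y t} → x < y → 0# < t → t < 1# →
    x < (1# - t) * x + t * y × (1# - t) * x + t * y < y
  convex-combination-between {x} {y} {t} x<y 0<t t<1 =
    0<y-x⇒x<y (subst (0# <_) (solve 3 (λ x y t → t :* (y :- x) := (:1 :- t) :* x :+ t :* y :- x) refl x y t)
                 (*-pos 0<t (x<y⇒0<y-x x<y))) ,
    0<y-x⇒x<y (subst (0# <_) (solve 3 (λ x y t → (:1 :- t) :* (y :- x) := y :- ((:1 :- t) :* x :+ t :* y)) refl x y t)
                 (*-pos (x<y⇒0<y-x t<1) (x<y⇒0<y-x x<y)))

module PlaneGeometry (F : OrderedField) where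

  open OrderedFieldProperties F
  open Geometry F using (Point; InOpenSegment; AllCollinear)

  -- The coefficients of a x + b y + c; a line only when NonDegenerate.
  record Line : Set where
    constructor line
    field a b c : Carrier

  value : Line → Point → Carrier
  value (line a b c) (x , y) = a * x + b * y + c

  infix 4 _∈ᴸ_
  _∈ᴸ_ : Point → Line → Set
  P ∈ᴸ ℓ = value ℓ P ≡ 0#

  NonDegenerate : Line → Set
  NonDegenerate (line a b c) = ¬ (a ≡ 0# × b ≡ 0#)

  perpendicular : Line → Line
  perpendicular (line a b c) = line b (- a) 0#

  position : Line → Point → Carrier
  position ℓ = value (perpendicular ℓ)

  combination : Carrier → Point → Point → Point
  combination t (ax , ay) (bx , by) = ((1# - t) * ax + t * bx , (1# - t) * ay + t * by)

  value-combination : ∀ ℓ t A B →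
    value ℓ (combination t A B) ≡ (1# - t) * value ℓ A + t * value ℓ B
  value-combination (line a b c) t (ax , ay) (bx , by) = identity a b c t ax ay bx by
    where
    identity : ∀ a b c t ax ay bx by →
      a * ((1# - t) * ax + t * bx) + b * ((1# - t) * ay + t * by) + c
        ≡ (1# - t) * (a * ax + b * ay + c) + t * (a * bx + b * by + c)
    identity = solve 8 (λ a b c t ax ay bx by →
      a :* ((:1 :- t) :* ax :+ t :* bx) :+ b :* ((:1 :- t) :* ay :+ t :* by) :+ c
        := (:1 :- t) :* (a :* ax :+ b :* ay :+ c) :+ t :* (a :* bx :+ b :* by :+ c)) refl

  InOpenSegment⇒combination : ∀ {Q A B} → InOpenSegment Q A B →
    Σ Carrier λ t → 0# < t × t < 1# × Q ≡ combination t A B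
  InOpenSegment⇒combination (t , 0<t , t<1 , qx≡ , qy≡) = t , 0<t , t<1 , cong₂ _,_ qx≡ qy≡

  segment-∈ᴸ : ∀ {ℓ Q A B} → InOpenSegment Q A B → A ∈ᴸ ℓ → B ∈ᴸ ℓ → Q ∈ᴸ ℓ
  segment-∈ᴸ {ℓ} {A = A} {B} Q∈AB A∈ℓ B∈ℓ with InOpenSegment⇒combination Q∈AB
  ... | t , _ , _ , refl = begin
    value ℓ (combination t A B)              ≡⟨ value-combination ℓ t A B ⟩
    (1# - t) * value ℓ A + t * value ℓ B     ≡⟨ s*0+t*0≡0 (1# - t) t A∈ℓ B∈ℓ ⟩
    0#                                       ∎
    where open ≡-Reasoning

  segment-value-between : ∀ {ℓ Q A B} → InOpenSegment Q A B → value ℓ A < value ℓ B →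
    value ℓ A < value ℓ Q × value ℓ Q < value ℓ B
  segment-value-between {ℓ} {A = A} {B} Q∈AB A<B with InOpenSegment⇒combination Q∈AB
  ... | t , 0<t , t<1 , refl = subst (λ v → value ℓ A < v × v < value ℓ B)
    (sym (value-combination ℓ t A B)) (convex-combination-between A<B 0<t t<1)

  -- value ℓ and position ℓ are affine coordinates on the plane.
  value-position-injective : ∀ {ℓ P Q} → NonDegenerate ℓ →
    value ℓ P ≡ value ℓ Q → position ℓ P ≡ position ℓ Q → P ≡ Q
  value-position-injective {line a b c} {px , py} {qx , qy} nondegenerate vP≡vQ posP≡posQ = cong₂ _,_
    (x≢0⇒x*[y-z]≡0⇒y≡z N≢0 (trans (identityˣ a b c px py qx qy) (s*0+t*0≡0 a b Δvalue≡0 Δposition≡0)))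
    (x≢0⇒x*[y-z]≡0⇒y≡z N≢0 (trans (identityʸ a b c px py qx qy) (s*0+t*0≡0 b (- a) Δvalue≡0 Δposition≡0)))
    where
    N≢0 : a * a + b * b ≢ 0#
    N≢0 = <⇒≢ (0<sum-of-squares nondegenerate) ∘ sym
    Δvalue≡0 : value (line a b c) (px , py) - value (line a b c) (qx , qy) ≡ 0#
    Δvalue≡0 = x≡y⇒x-y≡0 vP≡vQ
    Δposition≡0 : position (line a b c) (px , py) - position (line a b c) (qx , qy) ≡ 0#
    Δposition≡0 = x≡y⇒x-y≡0 posP≡posQ
    identityˣ : ∀ a b c px py qx qy → let ℓ = line a b c in (a * a + b * b) * (px - qx)
      ≡ a * (value ℓ (px , py) - value ℓ (qx , qy)) + b * (position ℓ (px , py) - position ℓ (qx , qy))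
    identityˣ = solve 7 (λ a b c px py qx qy → (a :* a :+ b :* b) :* (px :- qx)
      := a :* ((a :* px :+ b :* py :+ c) :- (a :* qx :+ b :* qy :+ c))
         :+ b :* ((b :* px :+ :- a :* py :+ :0) :- (b :* qx :+ :- a :* qy :+ :0))) refl
    identityʸ : ∀ a b c px py qx qy → let ℓ = line a b c in (a * a + b * b) * (py - qy)
      ≡ b * (value ℓ (px , py) - value ℓ (qx , qy)) + - a * (position ℓ (px , py) - position ℓ (qx , qy))
    identityʸ = solve 7 (λ a b c px py qx qy → (a :* a :+ b :* b) :* (py :- qy)
      := b :* ((a :* px :+ b :* py :+ c) :- (a :* qx :+ b :* qy :+ c))
         :+ :- a :* ((b :* px :+ :- a :* py :+ :0) :- (b :* qx :+ :- a :* qy :+ :0))) refl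

  between-∈-segment : ∀ {ℓ A B C} → NonDegenerate ℓ → A ∈ᴸ ℓ → B ∈ᴸ ℓ → C ∈ᴸ ℓ →
    position ℓ A < position ℓ C → position ℓ C < position ℓ B → InOpenSegment C A B
  between-∈-segment {ℓ} {A} {B} {C} nondegenerate A∈ℓ B∈ℓ C∈ℓ A<C C<B =
    t , 0<t , t<1 , cong proj₁ (sym C′≡C) , cong proj₂ (sym C′≡C)
    -- t is chosen so that C′ = combination t A B has the position of C; as C′ is on ℓ, it is C.
    where
    open ≡-Reasoning
    pA pB pC : Carrier
    pA = position ℓ A
    pB = position ℓ B
    pC = position ℓ C
    0<pB-pA : 0# < pB - pA
    0<pB-pA = x<y⇒0<y-x (<-trans A<C C<B)
    inverse-pB-pA : Σ Carrier λ y → (pB - pA) * y ≡ 1#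
    inverse-pB-pA = inverse (pB - pA) (<⇒≢ 0<pB-pA ∘ sym)
    D⁻¹ : Carrier
    D⁻¹ = proj₁ inverse-pB-pA
    D*D⁻¹≡1 : (pB - pA) * D⁻¹ ≡ 1#
    D*D⁻¹≡1 = proj₂ inverse-pB-pA
    0<D⁻¹ : 0# < D⁻¹
    0<D⁻¹ = 0<x⇒x*y≡1⇒0<y 0<pB-pA D*D⁻¹≡1
    t : Carrier
    t = (pC - pA) * D⁻¹
    0<t : 0# < t
    0<t = *-pos (x<y⇒0<y-x A<C) 0<D⁻¹
    t<1 : t < 1#
    t<1 = 0<y-x⇒x<y (subst (0# <_) [pB-pC]*D⁻¹≡1-t (*-pos (x<y⇒0<y-x C<B) 0<D⁻¹))
      where
      identity : ∀ pA pB pC D⁻¹ → (pB - pC) * D⁻¹ ≡ (pB - pA) * D⁻¹ - (pC - pA) * D⁻¹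
      identity = solve 4 (λ pA pB pC D⁻¹ → (pB :- pC) :* D⁻¹ := (pB :- pA) :* D⁻¹ :- (pC :- pA) :* D⁻¹) refl
      [pB-pC]*D⁻¹≡1-t : (pB - pC) * D⁻¹ ≡ 1# - t
      [pB-pC]*D⁻¹≡1-t = trans (identity pA pB pC D⁻¹) (cong (_- t) D*D⁻¹≡1)
    C′ : Point
    C′ = combination t A B
    C′≡C : C′ ≡ C
    C′≡C = value-position-injective nondegenerate
      (trans (segment-∈ᴸ (t , 0<t , t<1 , refl , refl) A∈ℓ B∈ℓ) (sym C∈ℓ))
      (begin
        position ℓ C′                       ≡⟨ value-combination (perpendicular ℓ) t A B ⟩
        (1# - t) * pA + t * pB              ≡⟨ identity pA pB pC D⁻¹ ⟩
        pA + (pC - pA) * ((pB - pA) * D⁻¹)  ≡⟨ cong (λ u → pA + (pC - pA) * u) D*D⁻¹≡1 ⟩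
        pA + (pC - pA) * 1#                 ≡⟨ solve 2 (λ pA pC → pA :+ (pC :- pA) :* :1 := pC) refl pA pC ⟩
        pC                                  ∎)
      where
      identity : ∀ pA pB pC D⁻¹ →
        (1# - (pC - pA) * D⁻¹) * pA + (pC - pA) * D⁻¹ * pB ≡ pA + (pC - pA) * ((pB - pA) * D⁻¹)
      identity = solve 4 (λ pA pB pC D⁻¹ → (:1 :- (pC :- pA) :* D⁻¹) :* pA :+ (pC :- pA) :* D⁻¹ :* pB
                            := pA :+ (pC :- pA) :* ((pB :- pA) :* D⁻¹)) refl

  through : Point → Point → Line
  through (ux , uy) (wx , wy) = line (uy - wy) (wx - ux) (ux * wy - wx * uy)

  ∈-through-left : ∀ U W → U ∈ᴸ through U W
  ∈-through-left (ux , uy) (wx , wy) = identity ux uy wx wy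
    where
    identity : ∀ ux uy wx wy → (uy - wy) * ux + (wx - ux) * uy + (ux * wy - wx * uy) ≡ 0#
    identity = solve 4 (λ ux uy wx wy → (uy :- wy) :* ux :+ (wx :- ux) :* uy :+ (ux :* wy :- wx :* uy) := :0) refl

  ∈-through-right : ∀ U W → W ∈ᴸ through U W
  ∈-through-right (ux , uy) (wx , wy) = identity ux uy wx wy
    where
    identity : ∀ ux uy wx wy → (uy - wy) * wx + (wx - ux) * wy + (ux * wy - wx * uy) ≡ 0#
    identity = solve 4 (λ ux uy wx wy → (uy :- wy) :* wx :+ (wx :- ux) :* wy :+ (ux :* wy :- wx :* uy) := :0) refl

  through-nondegenerate : ∀ {U W} → U ≢ W → NonDegenerate (through U W)
  through-nondegenerate U≢W (uy-wy≡0 , wx-ux≡0) =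
    U≢W (cong₂ _,_ (sym (x-y≡0⇒x≡y wx-ux≡0)) (x-y≡0⇒x≡y uy-wy≡0))

  position-through : ∀ {U W} → U ≢ W → position (through U W) U < position (through U W) W
  position-through {ux , uy} {wx , wy} U≢W =
    0<y-x⇒x<y (subst (0# <_) (identity ux uy wx wy) (0<sum-of-squares (through-nondegenerate U≢W)))
    where
    identity : ∀ ux uy wx wy →
      (uy - wy) * (uy - wy) + (wx - ux) * (wx - ux)
        ≡ ((wx - ux) * wx + - (uy - wy) * wy + 0#) - ((wx - ux) * ux + - (uy - wy) * uy + 0#)
    identity = solve 4 (λ ux uy wx wy → (uy :- wy) :* (uy :- wy) :+ (wx :- ux) :* (wx :- ux)
      := ((wx :- ux) :* wx :+ :- (uy :- wy) :* wy :+ :0) :- ((wx :- ux) :* ux :+ :- (uy :- wy) :* uy :+ :0)) refl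

  ∈-through-swap : ∀ {U W Z} → Z ∈ᴸ through U W → Z ∈ᴸ through W U
  ∈-through-swap {ux , uy} {wx , wy} {zx , zy} Z∈UW = trans (identity ux uy wx wy zx zy) (x≡0⇒-x≡0 Z∈UW)
    where
    identity : ∀ ux uy wx wy zx zy →
      (wy - uy) * zx + (ux - wx) * zy + (wx * uy - ux * wy)
        ≡ - ((uy - wy) * zx + (wx - ux) * zy + (ux * wy - wx * uy))
    identity = solve 6 (λ ux uy wx wy zx zy → (wy :- uy) :* zx :+ (ux :- wx) :* zy :+ (wx :* uy :- ux :* wy)
      := :- ((uy :- wy) :* zx :+ (wx :- ux) :* zy :+ (ux :* wy :- wx :* uy))) refl

  through-∩-through : ∀ {U W Z V} → ¬ Z ∈ᴸ through U W →
    V ∈ᴸ through U W → V ∈ᴸ through U Z → V ≡ U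
  through-∩-through {ux , uy} {wx , wy} {zx , zy} {vx , vy} Z∉UW V∈UW V∈UZ = cong₂ _,_
    (x≢0⇒x*[y-z]≡0⇒y≡z Z∉UW (trans (identityˣ ux uy wx wy zx zy vx vy) (s*0+t*0≡0 (zx - ux) (ux - wx) V∈UW V∈UZ)))
    (x≢0⇒x*[y-z]≡0⇒y≡z Z∉UW (trans (identityʸ ux uy wx wy zx zy vx vy) (s*0+t*0≡0 (zy - uy) (uy - wy) V∈UW V∈UZ)))
    where
    lineᴾ : ∀ {m} → (ux uy wx wy x y : Polynomial m) → Polynomial m
    lineᴾ ux uy wx wy x y = (uy :- wy) :* x :+ (wx :- ux) :* y :+ (ux :* wy :- wx :* uy)
    identityˣ : ∀ ux uy wx wy zx zy vx vy →
      value (through (ux , uy) (wx , wy)) (zx , zy) * (vx - ux)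
        ≡ (zx - ux) * value (through (ux , uy) (wx , wy)) (vx , vy)
          + (ux - wx) * value (through (ux , uy) (zx , zy)) (vx , vy)
    identityˣ = solve 8 (λ ux uy wx wy zx zy vx vy → lineᴾ ux uy wx wy zx zy :* (vx :- ux)
      := (zx :- ux) :* lineᴾ ux uy wx wy vx vy :+ (ux :- wx) :* lineᴾ ux uy zx zy vx vy) refl
    identityʸ : ∀ ux uy wx wy zx zy vx vy →
      value (through (ux , uy) (wx , wy)) (zx , zy) * (vy - uy)
        ≡ (zy - uy) * value (through (ux , uy) (wx , wy)) (vx , vy)
          + (uy - wy) * value (through (ux , uy) (zx , zy)) (vx , vy)
    identityʸ = solve 8 (λ ux uy wx wy zx zy vx vy → lineᴾ ux uy wx wy zx zy :* (vy :- uy)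
      := (zy :- uy) :* lineᴾ ux uy wx wy vx vy :+ (uy :- wy) :* lineᴾ ux uy zx zy vx vy) refl

  collinear-on : ∀ {n} {p : Fin n → Point} (ℓ : Line) → NonDegenerate ℓ → (∀ i → p i ∈ᴸ ℓ) → AllCollinear p
  collinear-on (line a b c) nondegenerate on = a , b , c , nondegenerate , on

  ≤2-points-collinear : ∀ {n} (p : Fin n → Point) → Injective _≡_ _≡_ p → n ℕ.≤ 2 → AllCollinear p
  ≤2-points-collinear {0} _ _ _ = collinear-on (line 1# 0# 0#) (λ (1≡0 , _) → <⇒≢ 0<1 (sym 1≡0)) λ ()
  ≤2-points-collinear {1} p _ _ =
    collinear-on (line 1# 0# (- proj₁ (p zero))) (λ (1≡0 , _) → <⇒≢ 0<1 (sym 1≡0)) λ { zero → identity (p zero) }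
    where
    identity : ∀ P → 1# * proj₁ P + 0# * proj₂ P + - proj₁ P ≡ 0#
    identity (x , y) = solve 2 (λ x y → :1 :* x :+ :0 :* y :+ :- x := :0) refl x y
  ≤2-points-collinear {2} p p-injective _ =
    collinear-on (through (p zero) (p (suc zero))) (through-nondegenerate (0≢1+n ∘ p-injective)) λ where
      zero       → ∈-through-left (p zero) (p (suc zero))
      (suc zero) → ∈-through-right (p zero) (p (suc zero))
  ≤2-points-collinear {suc (suc (suc _))} _ _ (s≤s (s≤s ()))

module _ {n : ℕ} {P : Pred (Fin n) 0ℓ} (P? : Decidable P) where

  subsetOf : Subset n
  subsetOf = tabulate (does ∘ P?)

  ∈-subsetOf⁺ : ∀ {x} → P x → x ∈ subsetOf
  ∈-subsetOf⁺ {x} Px = lookup⇒[]= x subsetOf (trans (lookup∘tabulate (does ∘ P?) x) (dec-true (P? x) Px))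

  ∈-subsetOf⁻ : ∀ {x} → x ∈ subsetOf → P x
  ∈-subsetOf⁻ {x} x∈ with P? x | trans (sym (lookup∘tabulate (does ∘ P?) x)) ([]=⇒lookup x∈)
  ... | yes Px | _  = Px
  ... | no _   | ()

subsetOf-⊂ : ∀ {n} {P Q : Pred (Fin n) 0ℓ} (P? : Decidable P) (Q? : Decidable Q) →
  (∀ {x} → P x → Q x) → ∀ {x} → Q x → ¬ P x → subsetOf P? ⊂ subsetOf Q?
subsetOf-⊂ P? Q? P⊆Q {x} Qx ¬Px =
  (∈-subsetOf⁺ Q? ∘ P⊆Q ∘ ∈-subsetOf⁻ P?) , x , ∈-subsetOf⁺ Q? Qx , ¬Px ∘ ∈-subsetOf⁻ P?

another-element : ∀ {n} → 1 ℕ.< n → (v : Fin n) → ∃ λ u → u ≢ v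
another-element {suc zero}    (s≤s ())
another-element {suc (suc _)} _ v = punchIn v zero , punchInᵢ≢i v zero

a-third-element : ∀ {n} → 2 ℕ.< n → (u w : Fin n) → ∃ λ v → v ≢ u × v ≢ w
a-third-element {suc zero}          (s≤s ())
a-third-element {suc (suc zero)}    (s≤s (s≤s ()))
a-third-element {suc (suc (suc _))} _ u w with punchIn u zero ≟ᶠ w
... | no  u₀≢w = punchIn u zero , punchInᵢ≢i u zero , u₀≢w
... | yes u₀≡w = punchIn u (suc zero) , punchInᵢ≢i u (suc zero) ,
  λ u₁≡w → 0≢1+n (punchIn-injective u zero (suc zero) (trans u₀≡w (sym u₁≡w)))

⊆-singleton-avoiding : ∀ {n} {X : Subset n} {u w} → 2 ℕ.< n → ∣ X ∣ ℕ.< 2 → u ∉ X → w ∉ X →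
  ∃ λ v → u ∉ ⁅ v ⁆ × w ∉ ⁅ v ⁆ × X ⊆ ⁅ v ⁆
⊆-singleton-avoiding {X = X} {u} {w} 2<n ∣X∣<2 u∉X w∉X with nonempty? X
... | no empty = let v , v≢u , v≢w = a-third-element 2<n u w in
  v , x≢y⇒x∉⁅y⁆ (v≢u ∘ sym) , x≢y⇒x∉⁅y⁆ (v≢w ∘ sym) , λ {x} x∈X → contradiction (x , x∈X) empty
... | yes (v , v∈X) = v , ∉⁅v⁆ u∉X , ∉⁅v⁆ w∉X , X⊆⁅v⁆
  where
  ∉⁅v⁆ : ∀ {x} → x ∉ X → x ∉ ⁅ v ⁆
  ∉⁅v⁆ x∉X x∈⁅v⁆ = x∉X (subst (_∈ X) (sym (x∈⁅y⁆⇒x≡y v x∈⁅v⁆)) v∈X)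
  X⊆⁅v⁆ : X ⊆ ⁅ v ⁆
  X⊆⁅v⁆ {x} x∈X with x ≟ᶠ v
  ... | yes refl = x∈⁅x⁆ x
  ... | no  x≢v  = contradiction (subst (ℕ._< ∣ X ∣) (∣⁅x⁆∣≡1 v) ∣⁅v⁆∣<∣X∣) (ℕ.<⇒≱ ∣X∣<2)
    where
    ∣⁅v⁆∣<∣X∣ : ∣ ⁅ v ⁆ ∣ ℕ.< ∣ X ∣
    ∣⁅v⁆∣<∣X∣ = p⊂q⇒∣p∣<∣q∣ ((λ y∈⁅v⁆ → subst (_∈ X) (sym (x∈⁅y⁆⇒x≡y v y∈⁅v⁆)) v∈X) , x , x∈X , x≢y⇒x∉⁅y⁆ x≢v)

first-step : ∀ {A : Set} {R : A → A → Set} {u w} → Star R u w → u ≢ w → ∃ (R u)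
first-step ε        u≢u = contradiction refl u≢u
first-step (r ◅ _) _    = _ , r

module GraphConnectivity {n : ℕ} (G : Graph n) where

  open DecMembership (≡-dec (_≟ᶠ_ {n}) (_≟ᶠ_ {n})) using (_∈?_)

  Avoiding : Subset n → Graph n
  Avoiding X a b = a ∉ X × b ∉ X × G a b

  Avoiding-⊆ : ∀ {X Y} → X ⊆ Y → ∀ {a b} → Star (Avoiding Y) a b → Star (Avoiding X) a b
  Avoiding-⊆ X⊆Y = gmap id λ (a∉Y , b∉Y , g) → a∉Y ∘ X⊆Y , b∉Y ∘ X⊆Y , g

  vertex-deletion⇒2-connected : 2 ℕ.< n → (∀ v → ConnectedAvoiding G ⁅ v ⁆) → KConnected 2 G
  vertex-deletion⇒2-connected 2<n connected-without = 2<n , λ X ∣X∣<2 u w u∉X w∉X →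
    let v , u∉⁅v⁆ , w∉⁅v⁆ , X⊆⁅v⁆ = ⊆-singleton-avoiding 2<n ∣X∣<2 u∉X w∉X
    in Avoiding-⊆ X⊆⁅v⁆ (connected-without v u w u∉⁅v⁆ w∉⁅v⁆)

  Without : Fin n → Fin n → Graph n
  Without x y = RemoveEdges G ((x , y) ∷ [])

  ∉-removed : ∀ {c d t x y : Fin n} → c ≢ t → d ≢ t → t ≡ x ⊎ t ≡ y →
    ¬ ((c , d) ∈ˡ (x , y) ∷ [] ⊎ (d , c) ∈ˡ (x , y) ∷ [])
  ∉-removed c≢t _   (inj₁ refl) (inj₁ (here refl)) = c≢t refl
  ∉-removed _   d≢t (inj₂ refl) (inj₁ (here refl)) = d≢t refl
  ∉-removed _   d≢t (inj₁ refl) (inj₂ (here refl)) = d≢t refl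
  ∉-removed c≢t _   (inj₂ refl) (inj₂ (here refl)) = c≢t refl

  Avoiding-endpoint⇒Without : ∀ {t x y} → t ≡ x ⊎ t ≡ y →
    ∀ {a b} → Star (Avoiding ⁅ t ⁆) a b → Star (Without x y) a b
  Avoiding-endpoint⇒Without t∈xy = gmap id λ (c∉ , d∉ , g) → g , ∉-removed (x∉⁅y⁆⇒x≢y c∉) (x∉⁅y⁆⇒x≢y d∉) t∈xy

  2-connected⇒2-edge-connected : KConnected 2 G → KEdgeConnected 2 G
  2-connected⇒2-edge-connected (2<n , connected) = ℕ.<⇒≤ 2<n , λ where
      []             _                 u w → gmap id (λ (_ , _ , g) → g , λ { (inj₁ ()) ; (inj₂ ()) }) (walk u w)
      ((x , y) ∷ []) _                 u w → (edge-or-detour ⋆) (gmap id (λ (_ , _ , g) → g) (walk u w))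
      (_ ∷ _ ∷ _)    (s≤s (s≤s ()))
    where
    walk : ∀ u w → Star (Avoiding ⊥) u w
    walk u w = connected ⊥ (subst (ℕ._< 2) (sym (∣⊥∣≡0 n)) (s≤s z≤n)) u w ∉⊥ ∉⊥
    walk-without : ∀ v → ConnectedAvoiding G ⁅ v ⁆
    walk-without v = connected ⁅ v ⁆ (ℕ.≤-reflexive (cong suc (∣⁅x⁆∣≡1 v)))
    module _ {x y : Fin n} where
      -- Go through a third vertex v, avoiding t on the way to v and s on the way back.
      detour : ∀ {s t} → s ≡ x ⊎ s ≡ y → t ≡ x ⊎ t ≡ y → Star (Without x y) s t
      detour {s} {t} s∈xy t∈xy with s ≟ᶠ t
      ... | yes refl = ε
      ... | no  s≢t  = let v , v≢s , v≢t = a-third-element 2<n s t in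
        Avoiding-endpoint⇒Without t∈xy (walk-without t s v (x≢y⇒x∉⁅y⁆ s≢t) (x≢y⇒x∉⁅y⁆ v≢t))
        ◅◅ Avoiding-endpoint⇒Without s∈xy (walk-without s v t (x≢y⇒x∉⁅y⁆ v≢s) (x≢y⇒x∉⁅y⁆ (s≢t ∘ sym)))
      edge-or-detour : ∀ {c d} → G c d → Star (Without x y) c d
      edge-or-detour {c} {d} g with (c , d) ∈? ((x , y) ∷ []) ⊎-dec (d , c) ∈? ((x , y) ∷ [])
      ... | no  c-d-kept            = (g , c-d-kept) ◅ ε
      ... | yes (inj₁ (here refl)) = detour (inj₁ refl) (inj₂ refl)
      ... | yes (inj₂ (here refl)) = detour (inj₂ refl) (inj₁ refl)

  min-degree-2⇔distinct-neighbours : MinDegreeAtLeast 2 G ⇔ (∀ v → ∃₂ λ a b → a ≢ b × G v a × G v b)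
  min-degree-2⇔distinct-neighbours = mk⇔ to from
    where
    to : MinDegreeAtLeast 2 G → ∀ v → ∃₂ λ a b → a ≢ b × G v a × G v b
    to δ≥2 v = let f , f-injective , adjacent = δ≥2 v in
      f zero , f (suc zero) , 0≢1+n ∘ f-injective , adjacent zero , adjacent (suc zero)
    from : (∀ v → ∃₂ λ a b → a ≢ b × G v a × G v b) → MinDegreeAtLeast 2 G
    from neighbours v with neighbours v
    ... | a , b , a≢b , Gva , Gvb = f , f-injective , adjacent
      where
      f : Fin 2 → Fin n
      f zero       = a
      f (suc zero) = b
      f-injective : Injective _≡_ _≡_ f
      f-injective {zero}     {zero}     _   = refl
      f-injective {zero}     {suc zero} a≡b = contradiction a≡b a≢b
      f-injective {suc zero} {zero}     b≡a = contradiction (sym b≡a) a≢b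
      f-injective {suc zero} {suc zero} _   = refl
      adjacent : ∀ j → G v (f j)
      adjacent zero       = Gva
      adjacent (suc zero) = Gvb

  -- A walk out of v leaves along some edge va; a walk avoiding that edge leaves along another.
  2-edge-connected⇒min-degree-2 : KEdgeConnected 2 G → MinDegreeAtLeast 2 G
  2-edge-connected⇒min-degree-2 (1<n , connected) = Equivalence.from min-degree-2⇔distinct-neighbours λ v →
    let u , u≢v       = another-element 1<n v
        a , Gva , _   = first-step (connected [] (s≤s z≤n) v u) (u≢v ∘ sym)
        b , Gvb , vb∉ = first-step (connected ((v , a) ∷ []) (s≤s (s≤s z≤n)) v u) (u≢v ∘ sym)
    in a , b , (λ a≡b → vb∉ (inj₁ (here (cong (v ,_) (sym a≡b))))) , Gva , Gvb

  at-most-one-neighbour⇒¬min-degree-2 : ∀ e → (∀ a b → G e a → G e b → a ≡ b) → ¬ MinDegreeAtLeast 2 G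
  at-most-one-neighbour⇒¬min-degree-2 e unique δ≥2 =
    let a , b , a≢b , Gea , Geb = Equivalence.to min-degree-2⇔distinct-neighbours δ≥2 e in
    a≢b (unique a b Gea Geb)

module VisibilityGraph (F : OrderedField) {n : ℕ} (p : Fin n → Geometry.Point F)
                       (p-injective : Injective _≡_ _≡_ p) where

  open OrderedFieldProperties F
  open PlaneGeometry F
  open Geometry F using (AllCollinear; Visible)
  open GraphConnectivity (Visible p) using (Avoiding)
  open Extrema ≤-totalOrder using (argmin; f[argmin]≤f[xs])

  module Along (ℓ : Line) where

    Edge : Graph n
    Edge i j = p i ∈ᴸ ℓ × p j ∈ᴸ ℓ × Visible p i j

    pos : Fin n → Carrier
    pos i = position ℓ (p i)

    StrictlyBetween : Fin n → Fin n → Pred (Fin n) 0ℓ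
    StrictlyBetween a b j = p j ∈ᴸ ℓ × pos a < pos j × pos j < pos b

    strictlyBetween? : ∀ a b → Decidable (StrictlyBetween a b)
    strictlyBetween? a b j = value ℓ (p j) ≟ 0# ×-dec pos a <? pos j ×-dec pos j <? pos b

    visible-if-nothing-between : ∀ {a b} → p a ∈ᴸ ℓ → p b ∈ᴸ ℓ → pos a < pos b →
      (∀ j → ¬ StrictlyBetween a b j) → Visible p a b
    visible-if-nothing-between a∈ℓ b∈ℓ a<b nothing-between =
      (λ { refl → <-irrefl refl a<b }) ,
      λ (k , k∈ab) → nothing-between k (segment-∈ᴸ k∈ab a∈ℓ b∈ℓ , segment-value-between {perpendicular ℓ} k∈ab a<b)

    -- Induction on the set of points strictly between a and b: split at any such point.
    walk-along : ∀ {a b} → p a ∈ᴸ ℓ → p b ∈ᴸ ℓ → pos a < pos b → Star Edge a b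
    walk-along {a} {b} = walk (⊂-wellFounded (subsetOf (strictlyBetween? a b)))
      where
      walk : ∀ {a b} → Acc _⊂_ (subsetOf (strictlyBetween? a b)) →
        p a ∈ᴸ ℓ → p b ∈ᴸ ℓ → pos a < pos b → Star Edge a b
      walk {a} {b} (acc smaller) a∈ℓ b∈ℓ a<b with nonempty? (subsetOf (strictlyBetween? a b))
      ... | no empty = (a∈ℓ , b∈ℓ , visible-if-nothing-between a∈ℓ b∈ℓ a<b
                          λ j between → empty (j , ∈-subsetOf⁺ (strictlyBetween? a b) between)) ◅ ε
      ... | yes (j , j∈ab) with ∈-subsetOf⁻ (strictlyBetween? a b) j∈ab
      ...   | j∈ℓ , a<j , j<b = walk (smaller a-j⊂a-b) a∈ℓ j∈ℓ a<j ◅◅ walk (smaller j-b⊂a-b) j∈ℓ b∈ℓ j<b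
        where
        a-j⊂a-b : subsetOf (strictlyBetween? a j) ⊂ subsetOf (strictlyBetween? a b)
        a-j⊂a-b = subsetOf-⊂ (strictlyBetween? a j) (strictlyBetween? a b)
          (λ (k∈ℓ , a<k , k<j) → k∈ℓ , a<k , <-trans k<j j<b) (j∈ℓ , a<j , j<b) (λ (_ , _ , j<j) → <-irrefl refl j<j)
        j-b⊂a-b : subsetOf (strictlyBetween? j b) ⊂ subsetOf (strictlyBetween? a b)
        j-b⊂a-b = subsetOf-⊂ (strictlyBetween? j b) (strictlyBetween? a b)
          (λ (k∈ℓ , j<k , k<b) → k∈ℓ , <-trans a<j j<k , k<b) (j∈ℓ , a<j , j<b) (λ (_ , j<j , _) → <-irrefl refl j<j)

  open Along using (Edge; walk-along)

  walk-through : ∀ {u w} → u ≢ w → Star (Edge (through (p u) (p w))) u w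
  walk-through {u} {w} u≢w = walk-along (through (p u) (p w))
    (∈-through-left (p u) (p w)) (∈-through-right (p u) (p w)) (position-through (u≢w ∘ p-injective))

  avoiding-off-line : ∀ {ℓ v a b} → ¬ p v ∈ᴸ ℓ → Star (Edge ℓ) a b → Star (Avoiding ⁅ v ⁆) a b
  avoiding-off-line {ℓ} {v} v∉ℓ = gmap id λ (c∈ℓ , d∈ℓ , visible) → ∉⁅v⁆ c∈ℓ , ∉⁅v⁆ d∈ℓ , visible
    where
    ∉⁅v⁆ : ∀ {c} → p c ∈ᴸ ℓ → c ∉ ⁅ v ⁆
    ∉⁅v⁆ c∈ℓ c∈⁅v⁆ = v∉ℓ (subst (λ x → p x ∈ᴸ ℓ) (x∈⁅y⁆⇒x≡y _ c∈⁅v⁆) c∈ℓ)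

  point-off-line : ¬ AllCollinear p → ∀ ℓ → NonDegenerate ℓ → ∃ λ z → ¬ p z ∈ᴸ ℓ
  point-off-line ¬collinear ℓ nondegenerate =
    ¬∀⟶∃¬ n _ (λ z → value ℓ (p z) ≟ 0#) (¬collinear ∘ collinear-on ℓ nondegenerate)

  connected-without-vertex : ¬ AllCollinear p → ∀ v → ConnectedAvoiding (Visible p) ⁅ v ⁆
  connected-without-vertex ¬collinear v u w u∉⁅v⁆ w∉⁅v⁆ with u ≟ᶠ w
  ... | yes refl = ε
  ... | no u≢w with value (through (p u) (p w)) (p v) ≟ 0#
  ...   | no v∉uw = avoiding-off-line v∉uw (walk-through u≢w)
  ...   | yes v∈uw with point-off-line ¬collinear (through (p u) (p w)) (through-nondegenerate (u≢w ∘ p-injective))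
  ...     | z , z∉uw = avoiding-off-line v∉uz (walk-through u≢z) ◅◅ avoiding-off-line v∉zw (walk-through z≢w)
    where
    u≢z : u ≢ z
    u≢z refl = z∉uw (∈-through-left (p u) (p w))
    z≢w : z ≢ w
    z≢w refl = z∉uw (∈-through-right (p u) (p w))
    v∉uz : ¬ p v ∈ᴸ through (p u) (p z)
    v∉uz v∈uz = u∉⁅v⁆ (subst (_∈ ⁅ v ⁆) (p-injective (through-∩-through z∉uw v∈uw v∈uz)) (x∈⁅x⁆ v))
    v∉zw : ¬ p v ∈ᴸ through (p z) (p w)
    v∉zw v∈zw = w∉⁅v⁆ (subst (_∈ ⁅ v ⁆)
      (p-injective (through-∩-through (z∉uw ∘ ∈-through-swap) (∈-through-swap v∈uw) (∈-through-swap v∈zw)))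
      (x∈⁅x⁆ v))

  ¬collinear⇒2-connected : ¬ AllCollinear p → KConnected 2 (Visible p)
  ¬collinear⇒2-connected ¬collinear = GraphConnectivity.vertex-deletion⇒2-connected (Visible p)
    (ℕ.≰⇒> (¬collinear ∘ ≤2-points-collinear p p-injective)) (connected-without-vertex ¬collinear)

  collinear⇒vertex-with-at-most-one-neighbour : 1 ℕ.≤ n → AllCollinear p →
    ∃ λ e → ∀ i j → Visible p e i → Visible p e j → i ≡ j
  collinear⇒vertex-with-at-most-one-neighbour 1≤n (a , b , c , nondegenerate , on) = e , unique
    where
    pos : Fin n → Carrier
    pos = position (line a b c) ∘ p
    e : Fin n
    e = argmin pos (fromℕ< 1≤n) (allFin n)
    pos-injective : ∀ {i j} → pos i ≡ pos j → i ≡ j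
    pos-injective posᵢ≡posⱼ = p-injective (value-position-injective nondegenerate (trans (on _) (sym (on _))) posᵢ≡posⱼ)
    e<neighbour : ∀ {j} → Visible p e j → pos e < pos j
    e<neighbour {j} (e≢j , _) with lookup (f[argmin]≤f[xs] {f = pos} (fromℕ< 1≤n) (allFin n)) (∈-allFin j)
    ... | inj₁ e<j = e<j
    ... | inj₂ e≡j = contradiction (pos-injective e≡j) e≢j
    unique : ∀ i j → Visible p e i → Visible p e j → i ≡ j
    unique i j e-i e-j with compare (pos i) (pos j)
    ... | tri< i<j _ _ = contradiction
      (i , between-∈-segment nondegenerate (on e) (on j) (on i) (e<neighbour e-i) i<j) (proj₂ e-j)
    ... | tri≈ _ i≡j _ = pos-injective i≡j
    ... | tri> _ _ j<i = contradiction
      (j , between-∈-segment nondegenerate (on e) (on i) (on j) (e<neighbour e-j) j<i) (proj₂ e-i)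

  min-degree-2⇒¬collinear : 1 ℕ.≤ n → MinDegreeAtLeast 2 (Visible p) → ¬ AllCollinear p
  min-degree-2⇒¬collinear 1≤n δ≥2 collinear =
    let e , unique = collinear⇒vertex-with-at-most-one-neighbour 1≤n collinear in
    GraphConnectivity.at-most-one-neighbour⇒¬min-degree-2 (Visible p) e unique δ≥2

proposition12 : (F : OrderedField) → (n : ℕ) → n ≥ 1 →
    (p : Fin n → Geometry.Point F) → Injective _≡_ _≡_ p →
    ((¬ Geometry.AllCollinear F p) ⇔ KConnected 2 (Geometry.Visible F p)) ×
    ((¬ Geometry.AllCollinear F p) ⇔ KEdgeConnected 2 (Geometry.Visible F p)) ×
    ((¬ Geometry.AllCollinear F p) ⇔ MinDegreeAtLeast 2 (Geometry.Visible F p))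
proposition12 F n n≥1 p p-injective =
  mk⇔ ¬collinear⇒κ (δ⇒¬collinear ∘ λ⇒δ ∘ κ⇒λ) ,
  mk⇔ (κ⇒λ ∘ ¬collinear⇒κ) (δ⇒¬collinear ∘ λ⇒δ) ,
  mk⇔ (λ⇒δ ∘ κ⇒λ ∘ ¬collinear⇒κ) δ⇒¬collinear
  where
  open VisibilityGraph F p p-injective
  open GraphConnectivity (Geometry.Visible F p)
  G : Graph n
  G = Geometry.Visible F p
  ¬collinear⇒κ : ¬ Geometry.AllCollinear F p → KConnected 2 G
  ¬collinear⇒κ = ¬collinear⇒2-connected
  κ⇒λ : KConnected 2 G → KEdgeConnected 2 G
  κ⇒λ = 2-connected⇒2-edge-connected
  λ⇒δ : KEdgeConnected 2 G → MinDegreeAtLeast 2 G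
  λ⇒δ = 2-edge-connected⇒min-degree-2
  δ⇒¬collinear : MinDegreeAtLeast 2 G → ¬ Geometry.AllCollinear F p
  δ⇒¬collinear = min-degree-2⇒¬collinear n≥1
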